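{- Let $G$ be a finite abelian group and let $e_1, \dots, e_r \in G$ be independent elements of even order, say $\operatorname{ord}(e_i) = 2m_i$, with $m_1 + \dots + m_r \ge 2$. Let $e_0 = m_1 e_1 + \dots + m_r e_r$, $G_0 = \{e_0, e_1, \dots, e_r\}$ and $H = \mathcal{B}_{\pm}(G_0)$. Then $\Delta(H) = \{m_1 + \dots + m_r - 1\}$.
   Context: Elements $e_1,\dots,e_r$ are independent if $\sum a_i e_i = 0$ with $a_i\in\mathbb{Z}$ implies $a_ie_i=0$ for all $i$. For a subset $G_0$ of an abelian group $G$, a sequence over $G_0$ is a finite unordered list $S = g_1\cdots g_\ell$ of elements of $G_0$ (repetitions allowed), forming the free commutative monoid over $G_0$ under concatenation. $S$ is a plus-minus weighted zero-sum sequence if $\sum_i \epsilon_i g_i = 0$ for some $\epsilon_i\in\{+1,-1\}$; $\mathcal{B}_{\pm}(G_0)$ is the monoid of these. For a monoid $H$ with trivial unit group: an atom is a non-identity element not a product of two non-identity elements; $\mathsf{L}_H(a)$ is the set of $k$ such that $a$ is a product of $k$ atoms; for finite $L=\{a_0<\dots<a_k\}$, $\Delta(L)=\{a_i-a_{i-1}\}$; $\Delta(H)=\bigcup_{a\in H}\Delta(\mathsf{L}_H(a))$. -}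

module Defs where

open import Level using (_⊔_)
open import Algebra.Bundles using (AbelianGroup)
open import Data.Nat using (ℕ; zero; suc; _+_; _*_; _<_; _≤_; _∸_)
open import Data.Integer using (ℤ; +_; -[1+_])
open import Data.Fin using (Fin; zero; suc)
open import Data.Vec using (Vec; []; _∷_)
open import Data.List using (List; []; _∷_; length)
open import Data.List.Relation.Unary.All using (All)
open import Data.Bool using (Bool; true; false)
open import Data.Product using (Σ; _×_; _,_)
open import Relation.Nullary using (¬_)
open import Relation.Binary.PropositionalEquality using (_≡_)

∑ : ∀ {n} → (Fin n → ℕ) → ℕ
∑ {zero} f = 0
∑ {suc n} f = f zero + ∑ (λ i → f (suc i))

-- Generic notions for a monoid H given as a submonoid (predicate P) of the
-- free commutative monoid of sequences over an index set Fin n, a sequence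
-- being represented by its multiplicity function Fin n → ℕ
-- (concatenation = pointwise addition, identity = empty sequence).

module Factorization {p} {n : ℕ} (P : (Fin n → ℕ) → Set p) where

  Seq : Set
  Seq = Fin n → ℕ

  𝟙 : Seq
  𝟙 _ = 0

  _⊕_ : Seq → Seq → Seq
  (S ⊕ T) j = S j + T j

  _≐_ : Seq → Seq → Set
  S ≐ T = ∀ j → S j ≡ T j

  IsAtom : Seq → Set p
  IsAtom a = P a × ¬ (a ≐ 𝟙)
    × ¬ (Σ Seq λ b → Σ Seq λ c → P b × P c × ¬ (b ≐ 𝟙) × ¬ (c ≐ 𝟙) × (b ⊕ c) ≐ a)

  prod : List Seq → Seq
  prod [] = 𝟙
  prod (x ∷ xs) = x ⊕ prod xs

  _∈L_ : ℕ → Seq → Set p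
  k ∈L a = Σ (List Seq) λ as → All IsAtom as × length as ≡ k × prod as ≐ a

  _∈ΔL_ : ℕ → Seq → Set p
  d ∈ΔL a = Σ ℕ λ k → Σ ℕ λ l → k ∈L a × l ∈L a × k < l × d ≡ l ∸ k
    × (∀ j → k < j → j < l → ¬ (j ∈L a))

  _∈Δ : ℕ → Set p
  d ∈Δ = Σ Seq λ a → P a × d ∈ΔL a

module _ {c ℓ} (G : AbelianGroup c ℓ) where
  open AbelianGroup G renaming (Carrier to A)

  Finite : Set (c ⊔ ℓ)
  Finite = Σ ℕ λ n → Σ (Fin n → A) λ f → ∀ x → Σ (Fin n) λ i → f i ≈ x

  _·_ : ℕ → A → A
  zero · g = ε
  suc n · g = g ∙ (n · g)

  _⊙_ : ℤ → A → A
  (+ n) ⊙ g = n · g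
  -[1+ n ] ⊙ g = (suc n · g) ⁻¹

  gsum : ∀ {n} → (Fin n → A) → A
  gsum {zero} f = ε
  gsum {suc n} f = f zero ∙ gsum (λ i → f (suc i))

  HasOrder : A → ℕ → Set ℓ
  HasOrder g n = 0 < n × (n · g) ≈ ε × (∀ k → 0 < k → k < n → ¬ ((k · g) ≈ ε))

  Independent : ∀ {r} → (Fin r → A) → Set ℓ
  Independent {r} e = (a : Fin r → ℤ) → gsum (λ i → a i ⊙ e i) ≈ ε → ∀ i → (a i ⊙ e i) ≈ ε

  signed : Bool → A → A
  signed true g = g
  signed false g = g ⁻¹

  sumSigned : ∀ {k} → Vec Bool k → A → A
  sumSigned [] g = ε
  sumSigned (b ∷ bs) g = signed b g ∙ sumSigned bs g

  -- the sequence with multiplicities S over the elements g j is a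
  -- plus-minus weighted zero-sum sequence: each occurrence gets a sign
  IsPMZeroSum : ∀ {n} → (Fin n → A) → (Fin n → ℕ) → Set ℓ
  IsPMZeroSum {n} g S = Σ ((j : Fin n) → Vec Bool (S j)) λ σ →
    gsum (λ j → sumSigned (σ j) (g j)) ≈ ε

  e₀ : ∀ {r} → (Fin r → A) → (Fin r → ℕ) → A
  e₀ e m = gsum (λ i → m i · e i)

  G₀ : ∀ {r} → (Fin r → A) → (Fin r → ℕ) → Fin (suc r) → A
  G₀ e m zero = e₀ e m
  G₀ e m (suc i) = e i

  ΔB± : ∀ {r} → (Fin r → A) → (Fin r → ℕ) → ℕ → Set ℓ
  ΔB± e m d = Factorization._∈Δ (IsPMZeroSum (G₀ e m)) d

module Submission where

open import Defs
open import Algebra.Bundles using (AbelianGroup)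
open import Data.Nat using (ℕ; _*_; _≤_; _∸_; s≤s)
open import Data.Fin using (Fin; zero)
open import Function.Bundles using (_⇔_; mk⇔)
open import Relation.Binary.PropositionalEquality using (_≡_; refl)

-- Write U = e₀ e₁^m₁ ⋯ e_r^m_r and M = m₁ + ⋯ + m_r. By independence, a sequence
-- e₀^s₀ e₁^s₁ ⋯ e_r^s_r is a plus-minus weighted zero-sum sequence iff it is u·U + 2c
-- for some u ∈ ℕ and c ∈ ℕ^{r+1}: the sign pattern of eᵢ must make 2mᵢ divide s₀mᵢ + pᵢ − qᵢ,
-- which forces sᵢ = pᵢ + qᵢ ≡ s₀mᵢ (mod 2) and sᵢ ≥ mᵢ when s₀ is odd. Hence the atoms are
-- U and the squares g², and a factorization of a with u copies of U and |c| squares has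
-- length k = u + |c| and satisfies |a| = 2k + u(M − 1). Since U contains e₀ exactly once,
-- all factorizations of a have the same parity of u, so two lengths k < l force the shorter
-- one to use U at least twice and l ≥ k + M − 1; trading U·U for the squares of the elements
-- of U realises the length k + M − 1 itself. The element U·U has lengths 2 and M + 1.

module Arithmetic where

  open import Data.Nat.Base using (ℕ; zero; suc; _+_; _*_; _≤_; _<_; z≤n; s≤s; parity)
  open import Data.Nat.Properties
  open import Data.Nat.DivMod using (_%_; [m+kn]%n≡m%n; m<n⇒m%n≡m)
  open import Data.Nat.Divisibility using (_∣_; divides)
  open import Data.Nat.Tactic.RingSolver using (solve)
  open import Data.Parity.Base using (0ℙ) renaming (_+_ to _ℙ+_)
  import Data.Parity.Properties as ℙ
  open import Data.Fin.Base using (Fin; zero; suc)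
  open import Data.Product using (_×_; _,_; ∃-syntax)
  open import Data.Sum using (inj₁; inj₂)
  open import Data.List.Base using ([]; _∷_)
  open import Function.Base using (_∘_)
  open import Relation.Nullary using (yes; no; contradiction)
  open import Relation.Binary.PropositionalEquality
  open import Algebra.Properties.CommutativeSemigroup +-commutativeSemigroup
    using () renaming (interchange to +-interchange)

  ∑-cong : ∀ {k} {f g : Fin k → ℕ} → (∀ i → f i ≡ g i) → ∑ f ≡ ∑ g
  ∑-cong {zero} f≗g = refl
  ∑-cong {suc k} f≗g = cong₂ _+_ (f≗g zero) (∑-cong (f≗g ∘ suc))

  ∑-zero : ∀ k → ∑ {k} (λ _ → 0) ≡ 0
  ∑-zero zero = refl
  ∑-zero (suc k) = ∑-zero k

  ∑-distrib-+ : ∀ {k} (f g : Fin k → ℕ) → ∑ (λ i → f i + g i) ≡ ∑ f + ∑ g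
  ∑-distrib-+ {zero} f g = refl
  ∑-distrib-+ {suc k} f g = trans (cong (f zero + g zero +_) (∑-distrib-+ (f ∘ suc) (g ∘ suc)))
    (+-interchange (f zero) (g zero) (∑ (f ∘ suc)) (∑ (g ∘ suc)))

  *-distribˡ-∑ : ∀ {k} a (f : Fin k → ℕ) → ∑ (λ i → a * f i) ≡ a * ∑ f
  *-distribˡ-∑ {zero} a f = sym (*-zeroʳ a)
  *-distribˡ-∑ {suc k} a f =
    trans (cong (a * f zero +_) (*-distribˡ-∑ a (f ∘ suc))) (sym (*-distribˡ-+ a (f zero) _))

  ∑≡0⇒≡0 : ∀ {k} (f : Fin k → ℕ) → ∑ f ≡ 0 → ∀ i → f i ≡ 0
  ∑≡0⇒≡0 f ∑f≡0 zero = m+n≡0⇒m≡0 (f zero) ∑f≡0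
  ∑≡0⇒≡0 f ∑f≡0 (suc i) = ∑≡0⇒≡0 (f ∘ suc) (m+n≡0⇒n≡0 (f zero) ∑f≡0) i

  δ : ∀ {k} → Fin k → Fin k → ℕ
  δ zero zero = 1
  δ zero (suc _) = 0
  δ (suc _) zero = 0
  δ (suc t) (suc j) = δ t j

  ∑-δ : ∀ {k} (t : Fin k) → ∑ (δ t) ≡ 1
  ∑-δ {suc k} zero = cong suc (∑-zero k)
  ∑-δ (suc t) = ∑-δ t

  ∑-*δ : ∀ {k} (c : Fin k → ℕ) (j : Fin k) → ∑ (λ t → c t * δ t j) ≡ c j
  ∑-*δ {suc k} c zero = begin
    c zero * 1 + ∑ (λ t → c (suc t) * 0)
      ≡⟨ cong₂ _+_ (*-identityʳ (c zero)) (∑-cong (λ t → *-zeroʳ (c (suc t)))) ⟩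
    c zero + ∑ {k} (λ _ → 0)  ≡⟨ cong (c zero +_) (∑-zero k) ⟩
    c zero + 0                ≡⟨ +-identityʳ (c zero) ⟩
    c zero                    ∎
    where open ≡-Reasoning
  ∑-*δ c (suc j) = trans (cong (_+ ∑ (λ t → c (suc t) * δ t j)) (*-zeroʳ (c zero))) (∑-*δ (c ∘ suc) j)

  δ≤ : ∀ {k} {c : Fin k → ℕ} (t : Fin k) → c t ≢ 0 → ∀ j → δ t j ≤ c j
  δ≤ zero ct≢0 zero = n≢0⇒n>0 ct≢0
  δ≤ zero _ (suc j) = z≤n
  δ≤ (suc t) _ zero = z≤n
  δ≤ (suc t) ct≢0 (suc j) = δ≤ t ct≢0 j

  parity-+2* : ∀ a x → parity (a + 2 * x) ≡ parity a
  parity-+2* a x = begin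
    parity (a + 2 * x)          ≡⟨ ℙ.+-homo-+ a (2 * x) ⟩
    parity a ℙ+ parity (2 * x)  ≡⟨ cong (parity a ℙ+_) (ℙ.*-homo-* 2 x) ⟩
    parity a ℙ+ 0ℙ              ≡⟨ ℙ.+-identityʳ (parity a) ⟩
    parity a                    ∎
    where open ≡-Reasoning

  parity≡0ℙ⇒≡2* : ∀ n → parity n ≡ 0ℙ → ∃[ k ] n ≡ 2 * k
  parity≡0ℙ⇒≡2* zero _ = 0 , refl
  parity≡0ℙ⇒≡2* (suc (suc n)) even with parity≡0ℙ⇒≡2* n even
  ... | k , refl = suc k , sym (*-suc 2 k)

  ≤∧parity≡⇒≡+2* : ∀ {m n} → m ≤ n → parity m ≡ parity n → ∃[ k ] n ≡ m + 2 * k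
  ≤∧parity≡⇒≡+2* {m} {n} m≤n m∼n with m≤n⇒∃[o]m+o≡n m≤n
  ... | d , refl with parity≡0ℙ⇒≡2* d (ℙ.+-cancelˡ-≡ (parity m) _ _ d-even)
    where
    d-even : parity m ℙ+ parity d ≡ parity m ℙ+ 0ℙ
    d-even = trans (sym (ℙ.+-homo-+ m d)) (trans (sym m∼n) (sym (ℙ.+-identityʳ (parity m))))
  ... | k , refl = k , refl

  <∧parity≡⇒2+≤ : ∀ {m n} → m < n → parity m ≡ parity n → 2 + m ≤ n
  <∧parity≡⇒2+≤ {m} m<n m∼n with m≤n⇒m<n∨m≡n m<n
  ... | inj₁ 1+m<n = 1+m<n
  ... | inj₂ refl = contradiction (trans (sym m∼n) (sym (ℙ.suc-homo-⁻¹ m))) (ℙ.p≢p⁻¹ (parity (suc m)))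

  remainder-unique : ∀ {n q r j t} → q < n → r < n → q + j * n ≡ r + t * n → q ≡ r
  remainder-unique {n@(suc _)} {q} {r} {j} {t} q<n r<n eq = begin
    q               ≡⟨ m<n⇒m%n≡m q<n ⟨
    q % n           ≡⟨ [m+kn]%n≡m%n q j n ⟨
    (q + j * n) % n ≡⟨ cong (_% n) eq ⟩
    (r + t * n) % n ≡⟨ [m+kn]%n≡m%n r t n ⟩
    r % n           ≡⟨ m<n⇒m%n≡m r<n ⟩
    r               ∎
    where open ≡-Reasoning

  -- The hypotheses say X ≡ 0 and X ≡ u·m + p − q (mod 2m), written without subtraction.
  sign-count : ∀ {m u p q t X} → u ≤ 1 → 2 * m ∣ X → X + q ≡ u * m + p + t * (2 * m) →
               ∃[ k ] p + q ≡ u * m + 2 * k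
  sign-count {m} {u} {p} {q} {t} {X} u≤1 (divides j X≡j*2m) X+q≡ =
    ≤∧parity≡⇒≡+2* (u*m≤p+q u≤1) (begin
      parity (u * m)                   ≡⟨ parity-+2* (u * m) (p + t * m) ⟨
      parity (u * m + 2 * (p + t * m)) ≡⟨ cong parity doubled ⟨
      parity (p + q + 2 * (j * m))     ≡⟨ parity-+2* (p + q) (j * m) ⟩
      parity (p + q)                   ∎)
    where
    open ≡-Reasoning
    q+j*2m≡ : q + j * (2 * m) ≡ u * m + p + t * (2 * m)
    q+j*2m≡ = trans (+-comm q (j * (2 * m))) (trans (cong (_+ q) (sym X≡j*2m)) X+q≡)
    doubled : p + q + 2 * (j * m) ≡ u * m + 2 * (p + t * m)
    doubled = begin
      p + q + 2 * (j * m)         ≡⟨ solve (p ∷ q ∷ j ∷ m ∷ []) ⟩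
      q + j * (2 * m) + p         ≡⟨ cong (_+ p) q+j*2m≡ ⟩
      u * m + p + t * (2 * m) + p ≡⟨ solve (u ∷ m ∷ p ∷ t ∷ []) ⟩
      u * m + 2 * (p + t * m)     ∎
    u*m≤p+q : u ≤ 1 → u * m ≤ p + q
    u*m≤p+q z≤n = z≤n
    u*m≤p+q (s≤s z≤n) with m ≤? p + q
    ... | yes m≤p+q = subst (_≤ p + q) (sym (+-identityʳ m)) m≤p+q
    -- If p + q < m, then q and m + p are both the remainder of X + q modulo 2m.
    ... | no m≰p+q =
      contradiction (≤-trans (m≤m+n m p) (≤-trans (≤-reflexive (sym q≡m+p)) (m≤n+m q p))) m≰p+q
      where
      p+q<m : p + q < m
      p+q<m = ≰⇒> m≰p+q
      q≡m+p : q ≡ m + p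
      q≡m+p = remainder-unique {j = j} {t = t}
        (≤-trans (≤-<-trans (m≤n+m q p) p+q<m) (m≤m+n m (m + 0)))
        (+-monoʳ-< m (≤-<-trans (m≤m+n p q) (<-≤-trans p+q<m (m≤m+n m 0))))
        (trans q+j*2m≡ (cong (λ x → x + p + t * (2 * m)) (+-identityʳ m)))

  length-gap : ∀ {N k l u u′} → 2 * k + u * N ≡ 2 * l + u′ * N → parity u ≡ parity u′ → k < l →
               ∃[ w ] u ≡ 2 + w × k + N ≤ l
  length-gap {N} {k} {l} {u} {u′} eq u∼u′ k<l
    with m≤n⇒∃[o]m+o≡n (<∧parity≡⇒2+≤ u′<u (sym u∼u′))
    where
    u′<u : u′ < u
    u′<u = ≰⇒> λ u≤u′ → <⇒≱ k<l (*-cancelˡ-≤ 2 (+-cancelʳ-≤ (u′ * N) (2 * l) (2 * k)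
      (≤-trans (≤-reflexive (sym eq)) (+-monoʳ-≤ (2 * k) (*-monoˡ-≤ N u≤u′)))))
  ... | w′ , refl = u′ + w′ , refl , *-cancelˡ-≤ 2 (+-cancelʳ-≤ (u′ * N) _ _ (begin
    2 * (k + N) + u′ * N               ≤⟨ m≤m+n _ (w′ * N) ⟩
    2 * (k + N) + u′ * N + w′ * N      ≡⟨ solve (k ∷ N ∷ u′ ∷ w′ ∷ []) ⟩
    2 * k + (2 + u′ + w′) * N          ≡⟨ eq ⟩
    2 * l + u′ * N                     ∎))
    where open ≤-Reasoning


module MonoidGeneratedBy {n : ℕ} (U : Fin n → ℕ) where

  open import Data.Nat.Base using (ℕ; zero; suc; _+_; _*_; _∸_; _≤_; _<_; z≤n; s≤s; z<s; parity)
  open import Data.Nat.Properties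
  open import Data.Nat.Tactic.RingSolver using (solve-∀)
  open import Data.Fin.Base using (Fin; zero; suc)
  open import Data.Fin.Properties using (all?; ¬∀⟶∃¬)
  open import Data.List.Base using (List; []; _∷_; _++_; replicate; length)
  open import Data.List.Properties using (length-++; length-replicate)
  open import Data.List.Relation.Unary.All using (All; []; _∷_)
  open import Data.List.Relation.Unary.All.Properties using (++⁺; replicate⁺)
  open import Data.Product using (_×_; _,_; proj₂; ∃-syntax)
  open import Data.Sum using (_⊎_; inj₁; inj₂)
  open import Function.Base using (_∘_)
  open import Function.Bundles using (_⇔_; mk⇔; Equivalence)
  open import Relation.Nullary using (¬_; yes; no; contradiction)
  open import Relation.Nullary.Decidable using (decidable-stable)
  open import Relation.Binary.PropositionalEquality

  open Arithmetic

  infixl 6 _U+2·_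

  _U+2·_ : ℕ → (Fin n → ℕ) → Fin n → ℕ
  (u U+2· c) j = u * U j + 2 * c j

  Generated : (Fin n → ℕ) → Set
  Generated S = ∃[ u ] ∃[ c ] ∀ j → S j ≡ (u U+2· c) j

  module LengthSets (o : Fin n) (Uo≡1 : U o ≡ 1) (3≤∑U : 3 ≤ ∑ U)
                    {p} (P : (Fin n → ℕ) → Set p) (P⇔Generated : ∀ S → P S ⇔ Generated S) where

    open Factorization P

    N : ℕ
    N = ∑ U ∸ 2

    ∑U≡2+N : ∑ U ≡ 2 + N
    ∑U≡2+N = sym (m+[n∸m]≡n (≤-trans (n≤1+n 2) 3≤∑U))

    1≤N : 1 ≤ N
    1≤N = ∸-monoˡ-≤ 2 3≤∑U

    P⇒Generated : ∀ {S} → P S → Generated S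
    P⇒Generated {S} = Equivalence.to (P⇔Generated S)

    Generated⇒P : ∀ {S} → Generated S → P S
    Generated⇒P {S} = Equivalence.from (P⇔Generated S)

    ∑-U+2· : ∀ u c → ∑ (u U+2· c) ≡ 2 * (u + ∑ c) + u * N
    ∑-U+2· u c = begin
      ∑ (u U+2· c)                           ≡⟨ ∑-distrib-+ (λ j → u * U j) (λ j → 2 * c j) ⟩
      ∑ (λ j → u * U j) + ∑ (λ j → 2 * c j)  ≡⟨ cong₂ _+_ (*-distribˡ-∑ u U) (*-distribˡ-∑ 2 c) ⟩
      u * ∑ U + 2 * ∑ c     ≡⟨ cong (λ s → u * s + 2 * ∑ c) ∑U≡2+N ⟩
      u * (2 + N) + 2 * ∑ c ≡⟨ regroup u N (∑ c) ⟩
      2 * (u + ∑ c) + u * N ∎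
      where
      open ≡-Reasoning
      regroup : ∀ u N s → u * (2 + N) + 2 * s ≡ 2 * (u + s) + u * N
      regroup = solve-∀

    nonidentity-size : ∀ {S} → Generated S → ¬ S ≐ 𝟙 → 2 ≤ ∑ S
    nonidentity-size {S} (u , c , S≐) S≢𝟙 with u + ∑ c in eq
    ... | zero = contradiction S≐𝟙 S≢𝟙
      where
      S≐𝟙 : S ≐ 𝟙
      S≐𝟙 j rewrite S≐ j | m+n≡0⇒m≡0 u eq | ∑≡0⇒≡0 c (m+n≡0⇒n≡0 u eq) j = refl
    ... | suc s = begin
      2 * 1                  ≤⟨ *-monoʳ-≤ 2 (s≤s z≤n) ⟩
      2 * suc s              ≤⟨ m≤m+n (2 * suc s) (u * N) ⟩
      2 * suc s + u * N      ≡⟨ cong (λ x → 2 * x + u * N) eq ⟨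
      2 * (u + ∑ c) + u * N  ≡⟨ trans (∑-cong S≐) (∑-U+2· u c) ⟨
      ∑ S                    ∎
      where open ≤-Reasoning

    ∑-resp-⊕ : ∀ {b c x} → (b ⊕ c) ≐ x → ∑ b + ∑ c ≡ ∑ x
    ∑-resp-⊕ {b} {c} b⊕c≐x = trans (sym (∑-distrib-+ b c)) (∑-cong b⊕c≐x)

    U≢𝟙 : ¬ U ≐ 𝟙
    U≢𝟙 U≐𝟙 = 1+n≢0 (trans (sym Uo≡1) (U≐𝟙 o))

    U-generated : Generated U
    U-generated = 1 , 𝟙 , λ j → sym (trans (+-identityʳ (1 * U j)) (*-identityˡ (U j)))

    2+N≤∑ : ∀ {S} u c → S ≐ (suc u U+2· c) → 2 + N ≤ ∑ S
    2+N≤∑ {S} u c S≐ = begin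
      2 + N                                   ≤⟨ m≤m+n (2 + N) (2 * (u + ∑ c) + u * N) ⟩
      2 + N + (2 * (u + ∑ c) + u * N)         ≡⟨ regroup u N (∑ c) ⟩
      2 * (suc u + ∑ c) + suc u * N           ≡⟨ sym (trans (∑-cong S≐) (∑-U+2· (suc u) c)) ⟩
      ∑ S                                     ∎
      where
      open ≤-Reasoning
      regroup : ∀ u N s → 2 + N + (2 * (u + s) + u * N) ≡ 2 * (suc u + s) + suc u * N
      regroup = solve-∀

    U-overflow : ∀ {x y} → 2 + N ≤ x → 2 ≤ y → ¬ x + y ≡ ∑ U
    U-overflow {x} {y} 2+N≤x 2≤y x+y≡∑U = <-irrefl refl (begin-strict
      2 + N       <⟨ m<m+n (2 + N) (s≤s z≤n) ⟩
      2 + N + 2   ≤⟨ +-mono-≤ 2+N≤x 2≤y ⟩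
      x + y       ≡⟨ x+y≡∑U ⟩
      ∑ U         ≡⟨ ∑U≡2+N ⟩
      2 + N       ∎)
      where open ≤-Reasoning

    U-irreducible : ∀ {b c} → Generated b → Generated c → ¬ b ≐ 𝟙 → ¬ c ≐ 𝟙 → ¬ (b ⊕ c) ≐ U
    U-irreducible {b} {c} (zero , cb , b≐) (zero , cc , c≐) _ _ b⊕c≐U = 1ℙ≢0ℙ (begin
      parity 1                          ≡⟨ cong parity (trans (sym Uo≡1) (sym (b⊕c≐U o))) ⟩
      parity (b o + c o)                ≡⟨ cong parity (cong₂ _+_ (b≐ o) (c≐ o)) ⟩
      parity (2 * cb o + 2 * cc o)      ≡⟨ cong parity (sym (*-distribˡ-+ 2 (cb o) (cc o))) ⟩
      parity (2 * (cb o + cc o))        ≡⟨ parity-+2* 0 (cb o + cc o) ⟩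
      parity 0                          ∎)
      where
      open ≡-Reasoning
      1ℙ≢0ℙ : parity 1 ≢ parity 0
      1ℙ≢0ℙ ()
    U-irreducible {b} {c} (suc ub , cb , b≐) gc _ c≢𝟙 b⊕c≐U =
      U-overflow (2+N≤∑ ub cb b≐) (nonidentity-size gc c≢𝟙) (∑-resp-⊕ b⊕c≐U)
    U-irreducible {b} {c} gb (suc uc , cc , c≐) b≢𝟙 _ b⊕c≐U =
      U-overflow (2+N≤∑ uc cc c≐) (nonidentity-size gb b≢𝟙)
        (trans (+-comm (∑ c) (∑ b)) (∑-resp-⊕ b⊕c≐U))

    U-isAtom : IsAtom U
    U-isAtom = Generated⇒P U-generated , U≢𝟙 ,
      λ (b , c , Pb , Pc , b≢𝟙 , c≢𝟙 , b⊕c≐U) →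
        U-irreducible (P⇒Generated Pb) (P⇒Generated Pc) b≢𝟙 c≢𝟙 b⊕c≐U

    square : Fin n → Fin n → ℕ
    square t j = 2 * δ t j

    ∑-square : ∀ t → ∑ (square t) ≡ 2
    ∑-square t = trans (*-distribˡ-∑ 2 (δ t)) (cong (2 *_) (∑-δ t))

    square-isAtom : ∀ t → IsAtom (square t)
    square-isAtom t = Generated⇒P (0 , δ t , λ j → refl) , square≢𝟙 ,
      λ (b , c , Pb , Pc , b≢𝟙 , c≢𝟙 , b⊕c≐sq) → <-irrefl refl (begin-strict
        2           <⟨ m<m+n 2 z<s ⟩
        2 + 2       ≤⟨ +-mono-≤ (nonidentity-size (P⇒Generated Pb) b≢𝟙)
                                (nonidentity-size (P⇒Generated Pc) c≢𝟙) ⟩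
        ∑ b + ∑ c   ≡⟨ ∑-resp-⊕ b⊕c≐sq ⟩
        ∑ (square t) ≡⟨ ∑-square t ⟩
        2           ∎)
      where
      open ≤-Reasoning
      square≢𝟙 : ¬ square t ≐ 𝟙
      square≢𝟙 sq≐𝟙 = 1+n≢0 (trans (sym (∑-square t)) (trans (∑-cong sq≐𝟙) (∑-zero n)))

    cofactor-trivial : ∀ {x b c} → IsAtom x → P b → P c → ¬ b ≐ 𝟙 → (b ⊕ c) ≐ x → c ≐ 𝟙
    cofactor-trivial {c = c} (_ , _ , irreducible) Pb Pc b≢𝟙 b⊕c≐x =
      decidable-stable (all? (λ j → c j ≟ 0))
        λ c≢𝟙 → irreducible (_ , c , Pb , Pc , b≢𝟙 , c≢𝟙 , b⊕c≐x)

    atom≐factor : ∀ {x b c} → IsAtom x → IsAtom b → Generated c → (b ⊕ c) ≐ x → x ≐ b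
    atom≐factor {x} {b} {c} x-atom (Pb , b≢𝟙 , _) gc b⊕c≐x j = begin
      x j          ≡⟨ sym (b⊕c≐x j) ⟩
      b j + c j    ≡⟨ cong (b j +_) (cofactor-trivial x-atom Pb (Generated⇒P gc) b≢𝟙 b⊕c≐x j) ⟩
      b j + 0      ≡⟨ +-identityʳ (b j) ⟩
      b j          ∎
      where open ≡-Reasoning

    atom-classification : ∀ {x} → IsAtom x → x ≐ U ⊎ ∃[ t ] x ≐ square t
    atom-classification {x} x-atom@(Px , x≢𝟙 , _) with P⇒Generated Px
    ... | u , c , x≐ with all? (λ j → c j ≟ 0)
    ...   | no c≢𝟙 = let t , ct≢0 = ¬∀⟶∃¬ n _ (λ j → c j ≟ 0) c≢𝟙 in
      inj₂ (t , atom≐factor x-atom (square-isAtom t) (u , (λ j → c j ∸ δ t j) , λ _ → refl) (λ j → begin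
        2 * δ t j + (u * U j + 2 * (c j ∸ δ t j)) ≡⟨ regroup (δ t j) (u * U j) (c j ∸ δ t j) ⟩
        u * U j + 2 * (δ t j + (c j ∸ δ t j))
          ≡⟨ cong (λ y → u * U j + 2 * y) (m+[n∸m]≡n (δ≤ t ct≢0 j)) ⟩
        u * U j + 2 * c j                          ≡⟨ sym (x≐ j) ⟩
        x j                                        ∎))
      where
      open ≡-Reasoning
      regroup : ∀ d a e → 2 * d + (a + 2 * e) ≡ a + 2 * (d + e)
      regroup = solve-∀
    ...   | yes c≐𝟙 with u
    ...     | zero = contradiction (λ j → trans (x≐ j) (cong (2 *_) (c≐𝟙 j))) x≢𝟙
    ...     | suc u′ = inj₁ (atom≐factor x-atom U-isAtom (u′ , c , λ _ → refl)
                               λ j → trans (sym (+-assoc (U j) (u′ * U j) (2 * c j))) (sym (x≐ j)))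

    factorization-shape : ∀ {as} → All IsAtom as →
                          ∃[ u ] ∃[ c ] prod as ≐ (u U+2· c) × length as ≡ u + ∑ c
    factorization-shape [] = 0 , 𝟙 , (λ _ → refl) , sym (∑-zero n)
    factorization-shape {x ∷ as} (x-atom ∷ atoms) with factorization-shape atoms | atom-classification x-atom
    ... | u , c , as≐ , len | inj₁ x≐U =
      suc u , c , (λ j → trans (cong₂ _+_ (x≐U j) (as≐ j)) (sym (+-assoc (U j) (u * U j) (2 * c j)))) ,
      cong suc len
    ... | u , c , as≐ , len | inj₂ (t , x≐sq) =
      u , c ⊕ δ t , (λ j → trans (cong₂ _+_ (x≐sq j) (as≐ j)) (regroup (δ t j) (u * U j) (c j))) , (begin
        suc (length as)         ≡⟨ cong suc len ⟩
        suc (u + ∑ c)           ≡⟨ sym (+-suc u (∑ c)) ⟩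
        u + suc (∑ c)           ≡⟨ cong (u +_) (+-comm 1 (∑ c)) ⟩
        u + (∑ c + 1)           ≡⟨ cong (λ y → u + (∑ c + y)) (sym (∑-δ t)) ⟩
        u + (∑ c + ∑ (δ t))     ≡⟨ cong (u +_) (sym (∑-distrib-+ c (δ t))) ⟩
        u + ∑ (c ⊕ δ t)         ∎)
      where
      open ≡-Reasoning
      regroup : ∀ d a e → 2 * d + (a + 2 * e) ≡ a + 2 * (e + d)
      regroup = solve-∀

    powers : ∀ {k} → (Fin k → Seq) → (Fin k → ℕ) → List Seq
    powers {zero} x c = []
    powers {suc k} x c = replicate (c zero) (x zero) ++ powers (x ∘ suc) (c ∘ suc)

    prod-++ : ∀ xs ys → prod (xs ++ ys) ≐ (prod xs ⊕ prod ys)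
    prod-++ [] ys j = refl
    prod-++ (x ∷ xs) ys j = trans (cong (x j +_) (prod-++ xs ys j)) (sym (+-assoc (x j) _ _))

    prod-replicate : ∀ k x j → prod (replicate k x) j ≡ k * x j
    prod-replicate zero x j = refl
    prod-replicate (suc k) x j = cong (x j +_) (prod-replicate k x j)

    prod-powers : ∀ {k} x c j → prod (powers {k} x c) j ≡ ∑ (λ t → c t * x t j)
    prod-powers {zero} x c j = refl
    prod-powers {suc k} x c j = trans (prod-++ (replicate (c zero) (x zero)) _ j)
      (cong₂ _+_ (prod-replicate (c zero) (x zero) j) (prod-powers (x ∘ suc) (c ∘ suc) j))

    length-powers : ∀ {k} x c → length (powers {k} x c) ≡ ∑ c
    length-powers {zero} x c = refl
    length-powers {suc k} x c = trans (length-++ (replicate (c zero) (x zero)))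
      (cong₂ _+_ (length-replicate (c zero)) (length-powers (x ∘ suc) (c ∘ suc)))

    powers-atoms : ∀ {k} x c → (∀ t → IsAtom (x t)) → All IsAtom (powers {k} x c)
    powers-atoms {zero} x c atoms = []
    powers-atoms {suc k} x c atoms =
      ++⁺ (replicate⁺ (c zero) (atoms zero)) (powers-atoms (x ∘ suc) (c ∘ suc) (atoms ∘ suc))

    U+2·-factorization : ∀ u c → (u + ∑ c) ∈L (u U+2· c)
    U+2·-factorization u c =
      as , ++⁺ (replicate⁺ u U-isAtom) (powers-atoms square c square-isAtom) ,
      trans (length-++ (replicate u U)) (cong₂ _+_ (length-replicate u) (length-powers square c)) ,
      λ j → trans (prod-++ (replicate u U) _ j) (cong₂ _+_ (prod-replicate u U j) (squares j))
      where
      as : List Seq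
      as = replicate u U ++ powers square c
      squares : ∀ j → prod (powers square c) j ≡ 2 * c j
      squares j = begin
        prod (powers square c) j          ≡⟨ prod-powers square c j ⟩
        ∑ (λ t → c t * (2 * δ t j))       ≡⟨ ∑-cong (λ t → *-2*-comm (c t) (δ t j)) ⟩
        ∑ (λ t → 2 * (c t * δ t j))       ≡⟨ *-distribˡ-∑ 2 (λ t → c t * δ t j) ⟩
        2 * ∑ (λ t → c t * δ t j)         ≡⟨ cong (2 *_) (∑-*δ c j) ⟩
        2 * c j                           ∎
        where
        open ≡-Reasoning
        *-2*-comm : ∀ a d → a * (2 * d) ≡ 2 * (a * d)
        *-2*-comm = solve-∀

    ∈L-resp-≐ : ∀ {k a b} → a ≐ b → k ∈L a → k ∈L b
    ∈L-resp-≐ a≐b (as , atoms , len , as≐a) = as , atoms , len , λ j → trans (as≐a j) (a≐b j)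

    length-shape : ∀ {k a} → k ∈L a → ∃[ u ] ∃[ c ] a ≐ (u U+2· c) × k ≡ u + ∑ c
    length-shape (as , atoms , refl , as≐a) with factorization-shape atoms
    ... | u , c , as≐ , len = u , c , (λ j → trans (sym (as≐a j)) (as≐ j)) , len

    ∑-length : ∀ {k a u c} → a ≐ (u U+2· c) → k ≡ u + ∑ c → ∑ a ≡ 2 * k + u * N
    ∑-length {u = u} {c} a≐ refl = trans (∑-cong a≐) (∑-U+2· u c)

    parity-at-o : ∀ {a} u c → a ≐ (u U+2· c) → parity (a o) ≡ parity u
    parity-at-o {a} u c a≐ = begin
      parity (a o)               ≡⟨ cong parity (a≐ o) ⟩
      parity (u * U o + 2 * c o) ≡⟨ parity-+2* (u * U o) (c o) ⟩
      parity (u * U o)           ≡⟨ cong (λ y → parity (u * y)) Uo≡1 ⟩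
      parity (u * 1)             ≡⟨ cong parity (*-identityʳ u) ⟩
      parity u                   ∎
      where open ≡-Reasoning

    lengths-separated : ∀ {k l a} → k ∈L a → l ∈L a → k < l → (k + N) ∈L a × k + N ≤ l
    lengths-separated {k} {l} {a} k∈ l∈ k<l with length-shape k∈ | length-shape l∈
    ... | u , c , a≐ , k≡ | u′ , c′ , a≐′ , l≡
      with length-gap {u = u} {u′ = u′} (trans (sym (∑-length a≐ k≡)) (∑-length a≐′ l≡))
                      (trans (sym (parity-at-o u c a≐)) (parity-at-o u′ c′ a≐′)) k<l
    ... | w , refl , k+N≤l =
      subst (_∈L a) length≡ (∈L-resp-≐ exchange (U+2·-factorization w (c ⊕ U))) , k+N≤l
      where
      open ≡-Reasoning
      -- U·U is also the product of the squares of the elements of U.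
      exchange : (w U+2· (c ⊕ U)) ≐ a
      exchange j = trans (regroup w (U j) (c j)) (sym (a≐ j))
        where
        regroup : ∀ w x y → w * x + 2 * (y + x) ≡ (2 + w) * x + 2 * y
        regroup = solve-∀
      length≡ : w + ∑ (c ⊕ U) ≡ k + N
      length≡ = begin
        w + ∑ (c ⊕ U)        ≡⟨ cong (w +_) (∑-distrib-+ c U) ⟩
        w + (∑ c + ∑ U)      ≡⟨ cong (λ y → w + (∑ c + y)) ∑U≡2+N ⟩
        w + (∑ c + (2 + N))  ≡⟨ regroup w (∑ c) N ⟩
        2 + w + ∑ c + N      ≡⟨ cong (_+ N) (sym k≡) ⟩
        k + N                ∎
        where
        regroup : ∀ w s N → w + (s + (2 + N)) ≡ 2 + w + s + N
        regroup = solve-∀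

    Δ-characterization : ∀ d → d ∈Δ ⇔ d ≡ N
    Δ-characterization d = mk⇔ only-N N-occurs
      where
      only-N : d ∈Δ → d ≡ N
      only-N (a , _ , k , l , k∈ , l∈ , k<l , d≡l∸k , gap) with lengths-separated k∈ l∈ k<l
      ... | k+N∈ , k+N≤l with m≤n⇒m<n∨m≡n k+N≤l
      ...   | inj₁ k+N<l = contradiction k+N∈ (gap (k + N) (m<m+n k 1≤N) k+N<l)
      ...   | inj₂ refl = trans d≡l∸k (m+n∸m≡n k N)

      U⊕U≐2U : (U ⊕ U) ≐ (0 U+2· U)
      U⊕U≐2U j = cong (U j +_) (sym (+-identityʳ (U j)))

      N-occurs : d ≡ N → d ∈Δ
      N-occurs refl =
        U ⊕ U , Generated⇒P (0 , U , U⊕U≐2U) , 2 , 2 + N , 2∈ , 2+N∈ , +-monoʳ-≤ 2 1≤N , refl , gap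
        where
        2∈ : 2 ∈L (U ⊕ U)
        2∈ = U ∷ U ∷ [] , U-isAtom ∷ U-isAtom ∷ [] , refl , λ j → cong (U j +_) (+-identityʳ (U j))
        2+N∈ : (2 + N) ∈L (U ⊕ U)
        2+N∈ = subst (_∈L (U ⊕ U)) ∑U≡2+N (∈L-resp-≐ (λ j → sym (U⊕U≐2U j)) (U+2·-factorization 0 U))
        gap : ∀ j → 2 < j → j < 2 + N → ¬ j ∈L (U ⊕ U)
        gap j 2<j j<2+N j∈ = <⇒≱ j<2+N (proj₂ (lengths-separated 2∈ j∈ 2<j))


module PlusMinusZeroSums {a ℓ} (G : AbelianGroup a ℓ) where

  import Algebra.Properties.Monoid.Mult as MonoidMult
  import Algebra.Properties.Monoid.Sum as MonoidSum
  import Algebra.Properties.CommutativeMonoid.Mult as CommutativeMonoidMult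
  import Algebra.Properties.CommutativeMonoid.Sum as CommutativeMonoidSum
  import Algebra.Properties.Group as GroupProperties
  open import Data.Nat.Base using (ℕ; zero; suc; _+_; _*_; _<_; z<s; pred; NonZero; >-nonZero)
  open import Data.Nat.Properties using (suc-pred; +-identityʳ; +-suc; *-identityʳ; *-distribʳ-+; ≤-pred)
  open import Data.Nat.DivMod using (_%_; _/_; m≡m%n+[m/n]*n; m%n<n)
  open import Data.Nat.Divisibility using (_∣_; m%n≡0⇒n∣m)
  open import Data.Nat.Tactic.RingSolver using (solve-∀)
  import Data.Integer.Base as ℤ
  open import Data.Fin.Base using (Fin; zero; suc)
  open import Data.Bool.Base using (Bool; true; false)
  open import Data.Vec.Base using (Vec; []; _∷_; _++_; replicate)
  open import Data.Product using (_,_; proj₁; proj₂; ∃-syntax)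
  open import Function.Base using (_∘_)
  open import Relation.Nullary using (contradiction)
  open import Relation.Binary.PropositionalEquality as ≡ using (_≡_)
  open Arithmetic using (sign-count)
  open MonoidGeneratedBy using (Generated)

  open AbelianGroup G renaming (Carrier to A; refl to ≈-refl)
  open MonoidMult monoid using (_×_; ×-homo-+; ×-homo-1; ×-assocˡ; ×-congʳ; ×-congˡ)
  open MonoidSum monoid using (sum; sum-cong-≋; sum-cong-≗; sum-replicate; sum-replicate-zero)
  open CommutativeMonoidMult commutativeMonoid using (×-distrib-+)
  open CommutativeMonoidSum commutativeMonoid using (∑-distrib-+)
  open GroupProperties group using (inverseʳ-unique)
  open import Relation.Binary.Reasoning.Setoid setoid

  ·≡× : ∀ n g → _·_ G n g ≡ n × g
  ·≡× zero g = ≡.refl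
  ·≡× (suc n) g = ≡.cong (g ∙_) (·≡× n g)

  gsum≡sum : ∀ {k} (f : Fin k → A) → gsum G f ≡ sum f
  gsum≡sum {zero} f = ≡.refl
  gsum≡sum {suc k} f = ≡.cong (f zero ∙_) (gsum≡sum (f ∘ suc))

  ×-ε : ∀ n → n × ε ≈ ε
  ×-ε n = trans (sym (sum-replicate n)) (sum-replicate-zero n)

  sum-ε : ∀ {k} (f : Fin k → A) → (∀ i → f i ≈ ε) → sum f ≈ ε
  sum-ε {k} f f≈ε = trans (sum-cong-≋ f≈ε) (sum-replicate-zero k)

  ×-sum : ∀ n {k} (f : Fin k → A) → n × sum f ≈ sum (λ i → n × f i)
  ×-sum n {zero} f = ×-ε n
  ×-sum n {suc k} f = trans (×-distrib-+ (f zero) (sum (f ∘ suc)) n) (∙-congˡ (×-sum n (f ∘ suc)))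

  order-divides : ∀ {g K n} → HasOrder G g K → n × g ≈ ε → K ∣ n
  order-divides {g} {K} {n} (0<K , K·g≈ε , minimal) ng≈ε =
    m%n≡0⇒n∣m n K (remainder≡0 (n % K) (m%n<n n K) rg≈ε)
    where
    instance
      K≢0 : NonZero K
      K≢0 = >-nonZero 0<K
    Kg≈ε : K × g ≈ ε
    Kg≈ε = trans (reflexive (≡.sym (·≡× K g))) K·g≈ε
    rg≈ε : (n % K) × g ≈ ε
    rg≈ε = begin
      (n % K) × g                         ≈⟨ sym (identityʳ _) ⟩
      (n % K) × g ∙ ε
        ≈⟨ ∙-congˡ (sym (trans (×-congʳ (n / K) Kg≈ε) (×-ε (n / K)))) ⟩
      (n % K) × g ∙ (n / K) × (K × g)     ≈⟨ ∙-congˡ (×-assocˡ g (n / K) K) ⟩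
      (n % K) × g ∙ (n / K * K) × g       ≈⟨ sym (×-homo-+ g (n % K) (n / K * K)) ⟩
      (n % K + n / K * K) × g             ≡⟨ ≡.cong (_× g) (≡.sym (m≡m%n+[m/n]*n n K)) ⟩
      n × g                               ≈⟨ ng≈ε ⟩
      ε                                   ∎
    remainder≡0 : ∀ r → r < K → r × g ≈ ε → r ≡ 0
    remainder≡0 zero _ _ = ≡.refl
    remainder≡0 (suc r) r<K rg≈ε =
      contradiction (trans (reflexive (·≡× (suc r) g)) rg≈ε) (minimal (suc r) z<s r<K)

  #⁺ #⁻ : ∀ {k} → Vec Bool k → ℕ
  #⁺ [] = 0
  #⁺ (true ∷ v) = suc (#⁺ v)
  #⁺ (false ∷ v) = #⁺ v
  #⁻ [] = 0
  #⁻ (true ∷ v) = #⁻ v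
  #⁻ (false ∷ v) = suc (#⁻ v)

  #⁺+#⁻≡length : ∀ {k} (v : Vec Bool k) → #⁺ v + #⁻ v ≡ k
  #⁺+#⁻≡length [] = ≡.refl
  #⁺+#⁻≡length (true ∷ v) = ≡.cong suc (#⁺+#⁻≡length v)
  #⁺+#⁻≡length (false ∷ v) = ≡.trans (+-suc (#⁺ v) (#⁻ v)) (≡.cong suc (#⁺+#⁻≡length v))

  sumSigned-torsion : ∀ {K g} → suc K × g ≈ ε → ∀ {k} (v : Vec Bool k) →
                      sumSigned G v g ≈ (#⁺ v + #⁻ v * K) × g
  sumSigned-torsion Kg≈ε [] = ≈-refl
  sumSigned-torsion Kg≈ε (true ∷ v) = ∙-congˡ (sumSigned-torsion Kg≈ε v)
  sumSigned-torsion {K} {g} Kg≈ε (false ∷ v) = begin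
    g ⁻¹ ∙ sumSigned G v g
      ≈⟨ ∙-cong (sym (inverseʳ-unique g (K × g) Kg≈ε)) (sumSigned-torsion Kg≈ε v) ⟩
    K × g ∙ (#⁺ v + #⁻ v * K) × g            ≈⟨ sym (×-homo-+ g K (#⁺ v + #⁻ v * K)) ⟩
    (K + (#⁺ v + #⁻ v * K)) × g              ≡⟨ ≡.cong (_× g) (regroup K (#⁺ v) (#⁻ v)) ⟩
    (#⁺ v + suc (#⁻ v) * K) × g              ∎
    where
    regroup : ∀ K p q → K + (p + q * K) ≡ p + suc q * K
    regroup = solve-∀

  sumSigned-++ : ∀ {k l} (xs : Vec Bool k) (ys : Vec Bool l) g →
                 sumSigned G (xs ++ ys) g ≈ sumSigned G xs g ∙ sumSigned G ys g
  sumSigned-++ [] ys g = sym (identityˡ _)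
  sumSigned-++ (x ∷ xs) ys g = trans (∙-congˡ (sumSigned-++ xs ys g)) (sym (assoc _ _ _))

  sumSigned-replicate : ∀ n b g → sumSigned G (replicate n b) g ≡ n × signed G b g
  sumSigned-replicate zero b g = ≡.refl
  sumSigned-replicate (suc n) b g = ≡.cong (signed G b g ∙_) (sumSigned-replicate n b g)

  sumSigned-subst : ∀ {k l} (eq : k ≡ l) (v : Vec Bool k) g →
                    sumSigned G (≡.subst (Vec Bool) eq v) g ≡ sumSigned G v g
  sumSigned-subst ≡.refl v g = ≡.refl

  balanced : ∀ k → Vec Bool (k + k)
  balanced k = replicate k true ++ replicate k false

  sumSigned-balanced : ∀ k g → sumSigned G (balanced k) g ≈ ε
  sumSigned-balanced k g = begin
    sumSigned G (balanced k) g       ≈⟨ sumSigned-++ (replicate k true) (replicate k false) g ⟩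
    _ ∙ _
      ≡⟨ ≡.cong₂ _∙_ (sumSigned-replicate k true g) (sumSigned-replicate k false g) ⟩
    k × g ∙ k × (g ⁻¹)               ≈⟨ sym (×-distrib-+ g (g ⁻¹) k) ⟩
    k × (g ∙ g ⁻¹)                   ≈⟨ ×-congʳ k (inverseʳ g) ⟩
    k × ε                            ≈⟨ ×-ε k ⟩
    ε                                ∎

  module ZeroSums {r} (e : Fin r → A) (m : Fin r → ℕ) (order : ∀ i → HasOrder G (e i) (2 * m i)) where

    U : Fin (suc r) → ℕ
    U zero = 1
    U (suc i) = m i

    e₀≡sum : e₀ G e m ≡ sum (λ i → m i × e i)
    e₀≡sum = ≡.trans (gsum≡sum (λ i → _·_ G (m i) (e i))) (sum-cong-≗ (λ i → ·≡× (m i) (e i)))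

    2m×e≈ε : ∀ i → (2 * m i) × e i ≈ ε
    2m×e≈ε i = trans (reflexive (≡.sym (·≡× (2 * m i) (e i)))) (proj₁ (proj₂ (order i)))

    e₀∙e₀≈ε : e₀ G e m ∙ e₀ G e m ≈ ε
    e₀∙e₀≈ε = begin
      e₀ G e m ∙ e₀ G e m                            ≡⟨ ≡.cong₂ _∙_ e₀≡sum e₀≡sum ⟩
      sum f ∙ sum f                                  ≈⟨ sym (∑-distrib-+ f f) ⟩
      sum (λ i → f i ∙ f i)                          ≈⟨ sum-ε (λ i → f i ∙ f i) doubled≈ε ⟩
      ε                                              ∎
      where
      f : Fin r → A
      f i = m i × e i
      doubled≈ε : ∀ i → m i × e i ∙ m i × e i ≈ ε
      doubled≈ε i = trans (sym (×-homo-+ (e i) (m i) (m i)))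
        (trans (×-congˡ (≡.cong (m i +_) (≡.sym (+-identityʳ (m i))))) (2m×e≈ε i))

    U-zeroSum : sum (λ j → U j × G₀ G e m j) ≈ ε
    U-zeroSum = trans (∙-cong (×-homo-1 _) (reflexive (≡.sym e₀≡sum))) e₀∙e₀≈ε

    generated⇒zeroSum : ∀ {S} → Generated U S → IsPMZeroSum G (G₀ G e m) S
    generated⇒zeroSum {S} (u , c , S≐) = σ , total
      where
      length≡ : ∀ j → u * U j + (c j + c j) ≡ S j
      length≡ j = ≡.sym (≡.trans (S≐ j) (≡.cong (λ y → u * U j + (c j + y)) (+-identityʳ (c j))))
      σ : (j : Fin (suc r)) → Vec Bool (S j)
      σ j = ≡.subst (Vec Bool) (length≡ j) (replicate (u * U j) true ++ balanced (c j))
      term : ∀ j → sumSigned G (σ j) (G₀ G e m j) ≈ u × (U j × G₀ G e m j)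
      term j = begin
        sumSigned G (σ j) g                              ≡⟨ sumSigned-subst (length≡ j) (pos ++ balanced (c j)) g ⟩
        sumSigned G (pos ++ balanced (c j)) g            ≈⟨ sumSigned-++ pos (balanced (c j)) g ⟩
        sumSigned G pos g ∙ sumSigned G (balanced (c j)) g
          ≈⟨ ∙-cong (reflexive (sumSigned-replicate (u * U j) true g)) (sumSigned-balanced (c j) g) ⟩
        (u * U j) × g ∙ ε                                ≈⟨ identityʳ _ ⟩
        (u * U j) × g                                    ≈⟨ sym (×-assocˡ g u (U j)) ⟩
        u × (U j × g)                                    ∎
        where
        g : A
        g = G₀ G e m j
        pos : Vec Bool (u * U j)
        pos = replicate (u * U j) true
      total : gsum G (λ j → sumSigned G (σ j) (G₀ G e m j)) ≈ ε
      total = begin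
        gsum G (λ j → sumSigned G (σ j) (G₀ G e m j))
          ≡⟨ gsum≡sum (λ j → sumSigned G (σ j) (G₀ G e m j)) ⟩
        sum (λ j → sumSigned G (σ j) (G₀ G e m j))     ≈⟨ sum-cong-≋ term ⟩
        sum (λ j → u × (U j × G₀ G e m j))             ≈⟨ sym (×-sum u (λ j → U j × G₀ G e m j)) ⟩
        u × sum (λ j → U j × G₀ G e m j)               ≈⟨ ×-congʳ u U-zeroSum ⟩
        u × ε                                          ≈⟨ ×-ε u ⟩
        ε                                              ∎

    K : Fin r → ℕ
    K i = pred (2 * m i)

    1+K≡2m : ∀ i → suc (K i) ≡ 2 * m i
    1+K≡2m i = suc-pred (2 * m i) {{>-nonZero (proj₁ (order i))}}

    -- S₀·mᵢ + pᵢ − qᵢ, where −1 is represented by Kᵢ = 2mᵢ − 1 since (2mᵢ)·eᵢ = 0.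
    coefficient : (S : Fin (suc r) → ℕ) → (∀ j → Vec Bool (S j)) → Fin r → ℕ
    coefficient S σ i = S zero * m i + (#⁺ (σ (suc i)) + #⁻ (σ (suc i)) * K i)

    signedSum≈ : ∀ {S : Fin (suc r) → ℕ} (σ : ∀ j → Vec Bool (S j)) →
                 gsum G (λ j → sumSigned G (σ j) (G₀ G e m j)) ≈ sum (λ i → coefficient S σ i × e i)
    signedSum≈ {S} σ = begin
      gsum G (λ j → sumSigned G (σ j) (G₀ G e m j))
        ≡⟨ gsum≡sum (λ j → sumSigned G (σ j) (G₀ G e m j)) ⟩
      sumSigned G (σ zero) (e₀ G e m) ∙ sum (λ i → sumSigned G (σ (suc i)) (e i))
        ≈⟨ ∙-cong e₀-part (sum-cong-≋ eᵢ-part) ⟩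
      sum (λ i → (S zero * m i) × e i) ∙ sum (λ i → (p i + q i * K i) × e i)
        ≈⟨ sym (∑-distrib-+ (λ i → (S zero * m i) × e i) (λ i → (p i + q i * K i) × e i)) ⟩
      sum (λ i → (S zero * m i) × e i ∙ (p i + q i * K i) × e i)
        ≈⟨ sum-cong-≋ (λ i → sym (×-homo-+ (e i) (S zero * m i) (p i + q i * K i))) ⟩
      sum (λ i → coefficient S σ i × e i) ∎
      where
      p q : Fin r → ℕ
      p i = #⁺ (σ (suc i))
      q i = #⁻ (σ (suc i))
      S₀≡ : #⁺ (σ zero) + #⁻ (σ zero) * 1 ≡ S zero
      S₀≡ = ≡.trans (≡.cong (#⁺ (σ zero) +_) (*-identityʳ (#⁻ (σ zero)))) (#⁺+#⁻≡length (σ zero))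
      e₀-part : sumSigned G (σ zero) (e₀ G e m) ≈ sum (λ i → (S zero * m i) × e i)
      e₀-part = begin
        sumSigned G (σ zero) (e₀ G e m)
          ≈⟨ sumSigned-torsion (trans (∙-congˡ (identityʳ _)) e₀∙e₀≈ε) (σ zero) ⟩
        (#⁺ (σ zero) + #⁻ (σ zero) * 1) × e₀ G e m ≡⟨ ≡.cong₂ _×_ S₀≡ e₀≡sum ⟩
        S zero × sum (λ i → m i × e i)             ≈⟨ ×-sum (S zero) (λ i → m i × e i) ⟩
        sum (λ i → S zero × (m i × e i))           ≈⟨ sum-cong-≋ (λ i → ×-assocˡ (e i) (S zero) (m i)) ⟩
        sum (λ i → (S zero * m i) × e i)           ∎
      eᵢ-part : ∀ i → sumSigned G (σ (suc i)) (e i) ≈ (p i + q i * K i) × e i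
      eᵢ-part i = sumSigned-torsion (trans (×-congˡ (1+K≡2m i)) (2m×e≈ε i)) (σ (suc i))

    zeroSum⇒2m∣coefficient : Independent G e → ∀ {S} (zeroSum : IsPMZeroSum G (G₀ G e m) S) →
                              ∀ i → 2 * m i ∣ coefficient S (proj₁ zeroSum) i
    zeroSum⇒2m∣coefficient independent {S} (σ , σ-zeroSum) i =
      order-divides (order i)
        (trans (reflexive (≡.sym (·≡× (X i) (e i)))) (independent (λ i → ℤ.+ X i) X-zeroSum i))
      where
      X : Fin r → ℕ
      X = coefficient S σ
      X-zeroSum : gsum G (λ i → _·_ G (X i) (e i)) ≈ ε
      X-zeroSum = begin
        gsum G (λ i → _·_ G (X i) (e i))                ≡⟨ gsum≡sum (λ i → _·_ G (X i) (e i)) ⟩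
        sum (λ i → _·_ G (X i) (e i))                   ≡⟨ sum-cong-≗ (λ i → ·≡× (X i) (e i)) ⟩
        sum (λ i → X i × e i)                           ≈⟨ signedSum≈ σ ⟨
        gsum G (λ j → sumSigned G (σ j) (G₀ G e m j))   ≈⟨ σ-zeroSum ⟩
        ε                                               ∎

    zeroSum⇒generated : Independent G e → ∀ {S} → IsPMZeroSum G (G₀ G e m) S → Generated U S
    zeroSum⇒generated independent {S} zeroSum@(σ , _) = u , c , S≐
      where
      u s : ℕ
      u = S zero % 2
      s = S zero / 2
      p q : Fin r → ℕ
      p i = #⁺ (σ (suc i))
      q i = #⁻ (σ (suc i))

      X+q≡ : ∀ i → coefficient S σ i + q i ≡ u * m i + p i + (s + q i) * (2 * m i)
      X+q≡ i = ≡.trans (≡.cong (λ y → y * m i + (p i + q i * K i) + q i) (m≡m%n+[m/n]*n (S zero) 2))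
        (≡.trans (regroup u s (m i) (p i) (q i) (K i))
        (≡.trans (≡.cong (λ y → u * m i + p i + (s * (2 * m i) + q i * y)) (1+K≡2m i))
        (≡.cong (u * m i + p i +_) (≡.sym (*-distribʳ-+ (2 * m i) s (q i))))))
        where
        regroup : ∀ u s m p q K → (u + s * 2) * m + (p + q * K) + q ≡ u * m + p + (s * (2 * m) + q * suc K)
        regroup = solve-∀

      pairs : ∀ i → ∃[ k ] p i + q i ≡ u * m i + 2 * k
      pairs i = sign-count {t = s + q i} (≤-pred (m%n<n (S zero) 2))
        (zeroSum⇒2m∣coefficient independent zeroSum i) (X+q≡ i)

      c : Fin (suc r) → ℕ
      c zero = s
      c (suc i) = proj₁ (pairs i)

      S≐ : ∀ j → S j ≡ u * U j + 2 * c j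
      S≐ zero = ≡.trans (m≡m%n+[m/n]*n (S zero) 2) (regroup u s)
        where
        regroup : ∀ u s → u + s * 2 ≡ u * 1 + 2 * s
        regroup = solve-∀
      S≐ (suc i) = ≡.trans (≡.sym (#⁺+#⁻≡length (σ (suc i)))) (proj₂ (pairs i))

lemma4p15 : ∀ {c ℓ} (G : AbelianGroup c ℓ) → Finite G →
    (r : ℕ) (e : Fin r → AbelianGroup.Carrier G) (m : Fin r → ℕ) →
    Independent G e →
    (∀ i → HasOrder G (e i) (2 * m i)) →
    2 ≤ ∑ m →
    ∀ d → ΔB± G e m d ⇔ (d ≡ ∑ m ∸ 1)
lemma4p15 G _ r e m independent order 2≤∑m =
  LengthSets.Δ-characterization zero refl (s≤s 2≤∑m) (IsPMZeroSum G (G₀ G e m))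
    (λ S → mk⇔ (zeroSum⇒generated independent) generated⇒zeroSum)
  where
  open PlusMinusZeroSums.ZeroSums G e m order
  open MonoidGeneratedBy U using (module LengthSets)
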